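{- For every $n\ge 5$, the $n\times n$ Bingo board has a spanning set $S$ of depth at least $2n$.
   Context: Let $X$ be the set of $n^2$ squares of an $n\times n$ grid. A \emph{line} is one of the $n$ rows, the $n$ columns, or one of the two main diagonals. A square $s$ is \emph{dependent} on $S\subseteq X$ if there is a line $L$ with $s\in L$ and $L\setminus\{s\}\subseteq S$; let $\varphi(S)$ be the set of squares dependent on $S$, and $\varphi_*(S)=S\cup\varphi(S)$. A set $K$ is \emph{closed} if $\varphi(K)\subseteq K$; the closure $\mathscr{C}(S)$ is the smallest closed set containing $S$. The \emph{depth} of $S$ is the smallest integer $d\ge 0$ with $\varphi_*^{d+1}(S)=\varphi_*^{d}(S)$ (with $\varphi_*^0(S)=S$). $S$ is \emph{spanning} if $\mathscr{C}(S)=X$. -}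

module Defs where

open import Level using (0ℓ)
open import Data.Nat using (ℕ; zero; suc)
open import Data.Fin using (Fin; opposite)
open import Data.Product using (Σ; _×_; _,_)
open import Data.Sum using (_⊎_)
open import Relation.Binary.PropositionalEquality using (_≡_; _≢_)
open import Relation.Nullary using (¬_)

Square : ℕ → Set
Square n = Fin n × Fin n

SqSet : ℕ → Set₁
SqSet n = Square n → Set

_⊆_ : ∀ {n} → SqSet n → SqSet n → Set
A ⊆ B = ∀ s → A s → B s

_≐_ : ∀ {n} → SqSet n → SqSet n → Set
A ≐ B = (A ⊆ B) × (B ⊆ A)

data Line (n : ℕ) : Set where
  row  : Fin n → Line n
  col  : Fin n → Line n
  diag : Line n
  anti : Line n

_∈L_ : ∀ {n} → Square n → Line n → Set
(i , j) ∈L row r = i ≡ r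
(i , j) ∈L col c = j ≡ c
(i , j) ∈L diag  = i ≡ j
(i , j) ∈L anti  = j ≡ opposite i

φ : ∀ {n} → SqSet n → SqSet n
φ S s = Σ (Line _) λ L → (s ∈L L) × (∀ t → t ∈L L → t ≢ s → S t)

φ* : ∀ {n} → SqSet n → SqSet n
φ* S s = S s ⊎ φ S s

φ*^ : ∀ {n} → ℕ → SqSet n → SqSet n
φ*^ zero    S = S
φ*^ (suc d) S = φ* (φ*^ d S)

Closed : ∀ {n} → SqSet n → Set
Closed K = φ K ⊆ K

-- closure 𝒞(S): the smallest closed set containing S, i.e. the
-- intersection of all closed sets containing S.
Closure : ∀ {n} → SqSet n → Square n → Set₁
Closure {n} S s = (K : SqSet n) → Closed K → S ⊆ K → K s

Spanning : ∀ {n} → SqSet n → Set₁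
Spanning {n} S = (s : Square n) → Closure S s

IsDepth : ∀ {n} → SqSet n → ℕ → Set
IsDepth S d = (φ*^ (suc d) S ≐ φ*^ d S)
            × (∀ e → Data.Nat._<_ e d → ¬ (φ*^ (suc e) S ≐ φ*^ e S))

module Submission where

-- Rank the squares and let S be the squares of rank 0. If every line through a square of
-- rank v ≥ 1 contains another square of rank ≥ v − 1, while some line through it has all
-- its other squares of rank < v, then φ_*^e(S) is exactly the set of squares of rank ≤ e;
-- so S spans and its depth is the largest rank, provided every smaller positive rank occurs.
-- For n = 5 a table of ranks up to 10 is checked by evaluation. For n = 6 + k the ranks
-- 1, …, 5 sit in the top two rows, rows 2, …, 3 + k carry a staircase 2r + 2, 2r + 3 at
-- columns r + 2, r + 3, and the chain closes through column 2 and the last two rows,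
-- ending at rank 12 + 2k = 2n.

open import Defs
open import Level using (0ℓ)
open import Data.Empty using (⊥-elim)
open import Data.Fin as Fin using (Fin; opposite; toℕ; fromℕ<)
open import Data.Fin.Properties using (all?; any?; toℕ-fromℕ<; toℕ-injective; opposite-prop; toℕ<n)
open import Data.Nat using (ℕ; zero; suc; _+_; _*_; _∸_; _≤_; _<_; _≤?_; _<?_; _≟_; z≤n; s≤s)
open import Data.Nat.Properties
open import Data.Product using (Σ; ∃; _×_; _,_; proj₁; proj₂)
open import Data.Product.Properties using (≡-dec)
open import Data.Sum using (_⊎_; inj₁; inj₂)
open import Data.Vec using (Vec; []; _∷_; lookup)
open import Function using (id; _∘_)
open import Relation.Binary.Definitions using (DecidableEquality)
open import Relation.Binary.PropositionalEquality using (_≡_; _≢_; refl; sym; trans; cong; subst; subst₂)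
open import Relation.Nullary using (¬_; Dec; yes; no; ¬?)
open import Relation.Nullary.Decidable using (toWitness; map′; _×-dec_; _⊎-dec_; _→-dec_)
open import Relation.Unary using (Pred; Decidable)

φ-mono : ∀ {n} {A B : SqSet n} → A ⊆ B → φ A ⊆ φ B
φ-mono A⊆B s (L , s∈L , rest) = L , s∈L , λ t t∈L t≢s → A⊆B t (rest t t∈L t≢s)

φ*-mono : ∀ {n} {A B : SqSet n} → A ⊆ B → φ* A ⊆ φ* B
φ*-mono A⊆B s (inj₁ s∈A) = inj₁ (A⊆B s s∈A)
φ*-mono A⊆B s (inj₂ s∈φA) = inj₂ (φ-mono A⊆B s s∈φA)

φ*^-⊆-closed : ∀ {n} {S K : SqSet n} → Closed K → S ⊆ K → ∀ d → φ*^ d S ⊆ K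
φ*^-⊆-closed K-closed S⊆K zero = S⊆K
φ*^-⊆-closed K-closed S⊆K (suc d) s (inj₁ s∈φ*^d) = φ*^-⊆-closed K-closed S⊆K d s s∈φ*^d
φ*^-⊆-closed K-closed S⊆K (suc d) s (inj₂ s∈φφ*^d) =
  K-closed s (φ-mono (φ*^-⊆-closed K-closed S⊆K d) s s∈φφ*^d)

module _ {n : ℕ} (rank : Square n → ℕ) where

  Supported : Set
  Supported = ∀ s L → s ∈L L → 1 ≤ rank s →
    Σ (Square n) λ t → t ∈L L × t ≢ s × rank s ≤ suc (rank t)

  Triggered : Set
  Triggered = ∀ s → 1 ≤ rank s →
    Σ (Line n) λ L → s ∈L L × (∀ t → t ∈L L → t ≢ s → rank t < rank s)

  BoundedBy : ℕ → Set
  BoundedBy D = ∀ s → rank s ≤ D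

  Attains : ℕ → Set
  Attains D = ∀ {e} → e < D → Σ (Square n) λ s → rank s ≡ suc e

record RankCertificate (n D : ℕ) : Set where
  field
    rank      : Square n → ℕ
    supported : Supported rank
    triggered : Triggered rank
    bounded   : BoundedBy rank D
    attains   : Attains rank D

module _ {n D : ℕ} (cert : RankCertificate n D) where
  open RankCertificate cert

  RankAtMost : ℕ → SqSet n
  RankAtMost e s = rank s ≤ e

  φ*-RankAtMost : ∀ e → φ* (RankAtMost e) ⊆ RankAtMost (suc e)
  φ*-RankAtMost e s (inj₁ rank≤e) = m≤n⇒m≤1+n rank≤e
  φ*-RankAtMost e s (inj₂ (L , s∈L , rest)) with 1 ≤? rank s
  ... | no rank≱1 = ≤-trans (≤-reflexive (n<1⇒n≡0 (≰⇒> rank≱1))) z≤n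
  ... | yes rank≥1 with supported s L s∈L rank≥1
  ...   | t , t∈L , t≢s , rank-s≤1+rank-t = ≤-trans rank-s≤1+rank-t (s≤s (rest t t∈L t≢s))

  RankAtMost-φ* : ∀ e → RankAtMost (suc e) ⊆ φ* (RankAtMost e)
  RankAtMost-φ* e s rank≤1+e with rank s ≤? e
  ... | yes rank≤e = inj₁ rank≤e
  ... | no rank≰e with triggered s (≤-trans (s≤s z≤n) (≰⇒> rank≰e))
  ...   | L , s∈L , below =
    inj₂ (L , s∈L , λ t t∈L t≢s → ≤-pred (≤-trans (below t t∈L t≢s) rank≤1+e))

  φ*^-RankAtMost : ∀ e → φ*^ e (RankAtMost 0) ≐ RankAtMost e
  φ*^-RankAtMost zero = (λ _ h → h) , (λ _ h → h)
  φ*^-RankAtMost (suc e) =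
      (λ s h → φ*-RankAtMost e s (φ*-mono (proj₁ (φ*^-RankAtMost e)) s h))
    , (λ s h → φ*-mono (proj₂ (φ*^-RankAtMost e)) s (RankAtMost-φ* e s h))

  RankAtMost0-spanning : Spanning (RankAtMost 0)
  RankAtMost0-spanning s K K-closed S⊆K =
    φ*^-⊆-closed K-closed S⊆K D s (proj₂ (φ*^-RankAtMost D) s (bounded s))

  RankAtMost0-depth : IsDepth (RankAtMost 0) D
  RankAtMost0-depth = stable , unstable
    where
    stable : φ*^ (suc D) (RankAtMost 0) ≐ φ*^ D (RankAtMost 0)
    stable = (λ s _ → proj₂ (φ*^-RankAtMost D) s (bounded s)) , (λ _ → inj₁)

    unstable : ∀ e → e < D → ¬ (φ*^ (suc e) (RankAtMost 0) ≐ φ*^ e (RankAtMost 0))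
    unstable e e<D (grown⊆ , _) with attains e<D
    ... | s , rank≡1+e = <-irrefl refl (subst (_≤ e) rank≡1+e s∈stage-e)
      where s∈stage-e = proj₁ (φ*^-RankAtMost e) s
                          (grown⊆ s (proj₂ (φ*^-RankAtMost (suc e)) s (≤-reflexive rank≡1+e)))

deep-spanning-set : ∀ {n D} → RankCertificate n D → 2 * n ≤ D →
  Σ (SqSet n) λ S → Spanning S × Σ ℕ λ d → IsDepth S d × (2 * n ≤ d)
deep-spanning-set {D = D} cert 2n≤D =
  RankAtMost cert 0 , RankAtMost0-spanning cert , D , RankAtMost0-depth cert , 2n≤D

module _ {n : ℕ} where

  _≟□_ : DecidableEquality (Square n)
  _≟□_ = ≡-dec Fin._≟_ Fin._≟_

  _∈L?_ : (s : Square n) (L : Line n) → Dec (s ∈L L)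
  (i , j) ∈L? row r = i Fin.≟ r
  (i , j) ∈L? col c = j Fin.≟ c
  (i , j) ∈L? diag  = i Fin.≟ j
  (i , j) ∈L? anti  = j Fin.≟ opposite i

  all-squares? : {P : Pred (Square n) 0ℓ} → Decidable P → Dec (∀ s → P s)
  all-squares? P? = map′ (λ h (i , j) → h i j) (λ h i j → h (i , j))
    (all? λ i → all? λ j → P? (i , j))

  any-square? : {P : Pred (Square n) 0ℓ} → Decidable P → Dec (∃ P)
  any-square? P? = map′ (λ (i , j , p) → (i , j) , p) (λ ((i , j) , p) → i , j , p)
    (any? λ i → any? λ j → P? (i , j))

  all-lines? : {P : Pred (Line n) 0ℓ} → Decidable P → Dec (∀ L → P L)
  all-lines? {P} P? =
    map′ to from (all? (P? ∘ row) ×-dec all? (P? ∘ col) ×-dec P? diag ×-dec P? anti)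
    where
    to : (∀ i → P (row i)) × (∀ j → P (col j)) × P diag × P anti → ∀ L → P L
    to (rows , cols , d , a) (row i) = rows i
    to (rows , cols , d , a) (col j) = cols j
    to (rows , cols , d , a) diag    = d
    to (rows , cols , d , a) anti    = a
    from : (∀ L → P L) → (∀ i → P (row i)) × (∀ j → P (col j)) × P diag × P anti
    from h = h ∘ row , h ∘ col , h diag , h anti

  any-line? : {P : Pred (Line n) 0ℓ} → Decidable P → Dec (∃ P)
  any-line? {P} P? =
    map′ to from (any? (P? ∘ row) ⊎-dec any? (P? ∘ col) ⊎-dec P? diag ⊎-dec P? anti)
    where
    to : (∃ (P ∘ row)) ⊎ (∃ (P ∘ col)) ⊎ P diag ⊎ P anti → ∃ P
    to (inj₁ (i , p))               = row i , p
    to (inj₂ (inj₁ (j , p)))        = col j , p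
    to (inj₂ (inj₂ (inj₁ p)))       = diag , p
    to (inj₂ (inj₂ (inj₂ p)))       = anti , p
    from : ∃ P → (∃ (P ∘ row)) ⊎ (∃ (P ∘ col)) ⊎ P diag ⊎ P anti
    from (row i , p) = inj₁ (i , p)
    from (col j , p) = inj₂ (inj₁ (j , p))
    from (diag , p)  = inj₂ (inj₂ (inj₁ p))
    from (anti , p)  = inj₂ (inj₂ (inj₂ p))

  module _ (rank : Square n → ℕ) where

    supported? : Dec (Supported rank)
    supported? = all-squares? λ s → all-lines? λ L → (s ∈L? L) →-dec (1 ≤? rank s) →-dec
      any-square? λ t → (t ∈L? L) ×-dec ¬? (t ≟□ s) ×-dec (rank s ≤? suc (rank t))

    triggered? : Dec (Triggered rank)
    triggered? = all-squares? λ s → (1 ≤? rank s) →-dec any-line? λ L → (s ∈L? L) ×-dec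
      all-squares? λ t → (t ∈L? L) →-dec ¬? (t ≟□ s) →-dec (rank t <? rank s)

    bounded? : ∀ D → Dec (BoundedBy rank D)
    bounded? D = all-squares? λ s → rank s ≤? D

    attains? : ∀ D → Dec (Attains rank D)
    attains? = allUpTo? λ e → any-square? λ s → rank s ≟ suc e

certificate₅ : RankCertificate 5 10
certificate₅ = record
  { rank      = rank₅
  ; supported = toWitness {a? = supported? rank₅} _
  ; triggered = toWitness {a? = triggered? rank₅} _
  ; bounded   = toWitness {a? = bounded? rank₅ 10} _
  ; attains   = toWitness {a? = attains? rank₅ 10} _
  }
  where
  rank₅ : Square 5 → ℕ
  rank₅ (i , j) = lookup (lookup table i) j
    where
    table : Vec (Vec ℕ 5) 5
    table = (7 ∷ 9 ∷ 10 ∷ 0 ∷ 0 ∷ [])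
          ∷ (0 ∷ 8 ∷ 9  ∷ 0 ∷ 0 ∷ [])
          ∷ (0 ∷ 0 ∷ 3  ∷ 0 ∷ 4 ∷ [])
          ∷ (6 ∷ 0 ∷ 0  ∷ 0 ∷ 5 ∷ [])
          ∷ (2 ∷ 0 ∷ 0  ∷ 1 ∷ 0 ∷ [])
          ∷ []

-- A square (i , j) of the board of size 1 + m is addressed by r = toℕ i, by the same row
-- counted from the bottom, r' = toℕ (opposite i), and by c = toℕ j; carrying r' as a
-- separate argument lets a ranking match on the bottom rows.
module Coordinates (m : ℕ) (rank : ℕ → ℕ → ℕ → ℕ) where

  Mirror : ℕ → ℕ → Set
  Mirror r r' = r + r' ≡ m

  OtherColumnAbove : (r r' c v : ℕ) → Set
  OtherColumnAbove r r' c v = Σ ℕ λ c₂ → c₂ < suc m × c₂ ≢ c × v ≤ suc (rank r r' c₂)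

  OtherRowAbove : (at : ℕ → ℕ → ℕ) (r v : ℕ) → Set
  OtherRowAbove at r v = Σ ℕ λ σ → Σ ℕ λ σ' → Mirror σ σ' × σ ≢ r × v ≤ suc (rank σ σ' (at σ σ'))

  OtherColumnsBelow : (r r' c v : ℕ) → Set
  OtherColumnsBelow r r' c v = ∀ {c₂} → c₂ < suc m → c₂ ≢ c → rank r r' c₂ < v

  OtherRowsBelow : (at : ℕ → ℕ → ℕ) (r v : ℕ) → Set
  OtherRowsBelow at r v = ∀ {σ σ'} → Mirror σ σ' → σ ≢ r → rank σ σ' (at σ σ') < v

  Trigger : (r r' c v : ℕ) → Set
  Trigger r r' c v = OtherColumnsBelow r r' c v
                   ⊎ OtherRowsBelow (λ _ _ → c) r v
                   ⊎ (r ≡ c × OtherRowsBelow (λ σ _ → σ) r v)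
                   ⊎ (r' ≡ c × OtherRowsBelow (λ _ σ' → σ') r v)

  record CoordinateCertificate (D : ℕ) : Set where
    field
      row-supported  : ∀ {r r' c} → Mirror r r' → c < suc m → 1 ≤ rank r r' c →
                       OtherColumnAbove r r' c (rank r r' c)
      col-supported  : ∀ {r r' c} → Mirror r r' → c < suc m → 1 ≤ rank r r' c →
                       OtherRowAbove (λ _ _ → c) r (rank r r' c)
      diag-supported : ∀ {r r'} → Mirror r r' → 1 ≤ rank r r' r →
                       OtherRowAbove (λ σ _ → σ) r (rank r r' r)
      anti-supported : ∀ {r r'} → Mirror r r' → 1 ≤ rank r r' r' →
                       OtherRowAbove (λ _ σ' → σ') r (rank r r' r')
      triggered      : ∀ {r r' c} → Mirror r r' → c < suc m → 1 ≤ rank r r' c →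
                       Trigger r r' c (rank r r' c)
      bounded        : ∀ {r r' c} → Mirror r r' → c < suc m → rank r r' c ≤ D
      attains        : ∀ {e} → e < D →
                       Σ ℕ λ r → Σ ℕ λ r' → Σ ℕ λ c → Mirror r r' × c < suc m × rank r r' c ≡ suc e

  rankOf : Square (suc m) → ℕ
  rankOf (i , j) = rank (toℕ i) (toℕ (opposite i)) (toℕ j)

  mirror-opposite : (i : Fin (suc m)) → Mirror (toℕ i) (toℕ (opposite i))
  mirror-opposite i = trans (cong (toℕ i +_) (opposite-prop i)) (m+[n∸m]≡n (≤-pred (toℕ<n i)))

  row-with : ∀ {σ σ'} → Mirror σ σ' → Σ (Fin (suc m)) λ i → toℕ i ≡ σ × toℕ (opposite i) ≡ σ'
  row-with {σ} {σ'} σ+σ'≡m = i , toℕ-fromℕ< σ<1+m , (begin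
      toℕ (opposite i)  ≡⟨ opposite-prop i ⟩
      m ∸ toℕ i         ≡⟨ cong (m ∸_) (toℕ-fromℕ< σ<1+m) ⟩
      m ∸ σ             ≡⟨ cong (_∸ σ) (sym σ+σ'≡m) ⟩
      σ + σ' ∸ σ        ≡⟨ m+n∸m≡n σ σ' ⟩
      σ'                ∎)
    where
    open Relation.Binary.PropositionalEquality.≡-Reasoning
    σ<1+m : σ < suc m
    σ<1+m = s≤s (subst (σ ≤_) σ+σ'≡m (m≤m+n σ σ'))
    i : Fin (suc m)
    i = fromℕ< σ<1+m

  record Transversal (L : Line (suc m)) : Set where
    field
      columnAt     : Fin (suc m) → Fin (suc m)
      at           : ℕ → ℕ → ℕ
      toℕ-columnAt : ∀ i → toℕ (columnAt i) ≡ at (toℕ i) (toℕ (opposite i))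
      meets        : ∀ i → (i , columnAt i) ∈L L
      only         : ∀ {i j} → (i , j) ∈L L → j ≡ columnAt i

  column : ∀ j → Transversal (col j)
  column j = record
    { columnAt = λ _ → j ; at = λ _ _ → toℕ j ; toℕ-columnAt = λ _ → refl
    ; meets = λ _ → refl ; only = id }

  diagonal : Transversal diag
  diagonal = record
    { columnAt = id ; at = λ σ _ → σ ; toℕ-columnAt = λ _ → refl
    ; meets = λ _ → refl ; only = sym }

  antidiagonal : Transversal anti
  antidiagonal = record
    { columnAt = opposite ; at = λ _ σ' → σ' ; toℕ-columnAt = λ _ → refl
    ; meets = λ _ → refl ; only = id }

  module _ {L : Line (suc m)} (T : Transversal L) where
    open Transversal T

    rankOf-columnAt : ∀ i →
      rankOf (i , columnAt i) ≡ rank (toℕ i) (toℕ (opposite i)) (at (toℕ i) (toℕ (opposite i)))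
    rankOf-columnAt i = cong (rank _ _) (toℕ-columnAt i)

    transversal-witness : ∀ i {v} → OtherRowAbove at (toℕ i) v →
      Σ (Square (suc m)) λ t → t ∈L L × t ≢ (i , columnAt i) × v ≤ suc (rankOf t)
    transversal-witness i {v} (σ , σ' , mirror , σ≢i , v≤) with row-with {σ} {σ'} mirror
    ... | i₂ , refl , refl =
      (i₂ , columnAt i₂) , meets i₂ , (λ t≡s → σ≢i (cong (toℕ ∘ proj₁) t≡s)) ,
      subst (λ x → v ≤ suc x) (sym (rankOf-columnAt i₂)) v≤

    transversal-below : ∀ i {v} → OtherRowsBelow at (toℕ i) v →
      ∀ t → t ∈L L → t ≢ (i , columnAt i) → rankOf t < v
    transversal-below i {v} below (i₂ , j₂) t∈L t≢s with only t∈L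
    ... | refl = subst (_< v) (sym (rankOf-columnAt i₂))
                   (below (mirror-opposite i₂) λ i₂≡i → t≢s (cong (λ x → x , columnAt x) (toℕ-injective i₂≡i)))

  row-witness : ∀ i j {v} → OtherColumnAbove (toℕ i) (toℕ (opposite i)) (toℕ j) v →
    Σ (Square (suc m)) λ t → t ∈L row i × t ≢ (i , j) × v ≤ suc (rankOf t)
  row-witness i j {v} (c₂ , c₂<1+m , c₂≢j , v≤) =
    (i , fromℕ< c₂<1+m) , refl ,
    (λ t≡s → c₂≢j (trans (sym (toℕ-fromℕ< c₂<1+m)) (cong (toℕ ∘ proj₂) t≡s))) ,
    subst (λ c → v ≤ suc (rank (toℕ i) (toℕ (opposite i)) c)) (sym (toℕ-fromℕ< c₂<1+m)) v≤

  row-below : ∀ i j {v} → OtherColumnsBelow (toℕ i) (toℕ (opposite i)) (toℕ j) v →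
    ∀ t → t ∈L row i → t ≢ (i , j) → rankOf t < v
  row-below i j below (.i , j₂) refl t≢s =
    below (toℕ<n j₂) λ j₂≡j → t≢s (cong (i ,_) (toℕ-injective j₂≡j))

  toRankCertificate : ∀ {D} → CoordinateCertificate D → RankCertificate (suc m) D
  toRankCertificate {D} cc = record
    { rank = rankOf ; supported = supported ; triggered = triggered
    ; bounded = λ (i , j) → C.bounded (mirror-opposite i) (toℕ<n j) ; attains = attains }
    where
    module C = CoordinateCertificate cc

    supported : Supported rankOf
    supported (i , j) (row .i) refl h = row-witness i j (C.row-supported (mirror-opposite i) (toℕ<n j) h)
    supported (i , j) (col .j) refl h =
      transversal-witness (column j) i (C.col-supported (mirror-opposite i) (toℕ<n j) h)
    supported (i , .i) diag refl h = transversal-witness diagonal i (C.diag-supported (mirror-opposite i) h)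
    supported (i , .(opposite i)) anti refl h =
      transversal-witness antidiagonal i (C.anti-supported (mirror-opposite i) h)

    triggered : Triggered rankOf
    triggered (i , j) h with C.triggered (mirror-opposite i) (toℕ<n j) h
    ... | inj₁ below = row i , refl , row-below i j below
    ... | inj₂ (inj₁ below) = col j , refl , transversal-below (column j) i below
    ... | inj₂ (inj₂ (inj₁ (i≡j , below))) with toℕ-injective i≡j
    ...   | refl = diag , refl , transversal-below diagonal i below
    triggered (i , j) h | inj₂ (inj₂ (inj₂ (i'≡j , below))) with toℕ-injective i'≡j
    ...   | refl = anti , refl , transversal-below antidiagonal i below

    attains : Attains rankOf D
    attains e<D with C.attains e<D
    ... | r , r' , c , mirror , c<1+m , rank≡ with row-with {r} {r'} mirror
    ...   | i , refl , refl = (i , fromℕ< c<1+m) , trans (cong (rank _ _) (toℕ-fromℕ< c<1+m)) rank≡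

n≢1+n : ∀ {n} → n ≢ suc n
n≢1+n = 1+n≢n ∘ sym

m+n≡o⇒m≤o : ∀ {m n o} → m + n ≡ o → m ≤ o
m+n≡o⇒m≤o {m} {n} m+n≡o = subst (m ≤_) m+n≡o (m≤m+n m n)

m+1+n≡1+o⇒m+n≡o : ∀ {m n o} → m + suc n ≡ suc o → m + n ≡ o
m+1+n≡1+o⇒m+n≡o {m} {n} eq = suc-injective (trans (sym (+-suc m n)) eq)

[2+m]+[2+n]≡4+o⇒m+n≡o : ∀ {m n o} → 2 + m + (2 + n) ≡ 4 + o → m + n ≡ o
[2+m]+[2+n]≡4+o⇒m+n≡o eq = m+1+n≡1+o⇒m+n≡o (m+1+n≡1+o⇒m+n≡o (suc-injective (suc-injective eq)))

m+n≡o⇒[2+m]+[2+n]≡4+o : ∀ {m n o} → m + n ≡ o → 2 + m + (2 + n) ≡ 4 + o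
m+n≡o⇒[2+m]+[2+n]≡4+o {m} {n} eq =
  cong (2 +_) (trans (+-suc m (suc n)) (cong suc (trans (+-suc m n) (cong suc eq))))

double : ℕ → ℕ
double zero    = zero
double (suc n) = suc (suc (double n))

double-mono-≤ : ∀ {m n} → m ≤ n → double m ≤ double n
double-mono-≤ z≤n       = z≤n
double-mono-≤ (s≤s m≤n) = s≤s (s≤s (double-mono-≤ m≤n))

double-cancel-≤ : ∀ m n → double m ≤ suc (double n) → m ≤ n
double-cancel-≤ zero    n       _                 = z≤n
double-cancel-≤ (suc m) (suc n) (s≤s (s≤s 2m≤)) = s≤s (double-cancel-≤ m n 2m≤)
double-cancel-≤ (suc m) zero    (s≤s ())

2*-double : ∀ n → 2 * n ≡ double n
2*-double zero    = refl
2*-double (suc n) = cong suc (trans (+-suc n (n + 0)) (cong suc (2*-double n)))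

data Parity : ℕ → Set where
  even : ∀ q → Parity (double q)
  odd  : ∀ q → Parity (suc (double q))

parity : ∀ n → Parity n
parity zero = even 0
parity (suc n) with parity n
... | even q = odd q
... | odd q  = even (suc q)

bump : ℕ → ℕ
bump zero    = zero
bump (suc v) = 3 + v

-- Recursion along the diagonal makes band-at₂, band-at₃ and band-support inductions.
band : ℕ → ℕ → ℕ
band zero    2       = 2
band zero    3       = 3
band zero    _       = 0
band (suc r) zero    = 0
band (suc r) (suc c) = bump (band r c)

band-at₂ : ∀ r → band r (2 + r) ≡ 2 + double r
band-at₂ zero    = refl
band-at₂ (suc r) = cong bump (band-at₂ r)

band-at₃ : ∀ r → band r (3 + r) ≡ 3 + double r
band-at₃ zero    = refl
band-at₃ (suc r) = cong bump (band-at₃ r)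

band-support : ∀ r c → 1 ≤ band r c → c ≡ 2 + r ⊎ c ≡ 3 + r
band-support zero    2       _ = inj₁ refl
band-support zero    3       _ = inj₂ refl
band-support zero    0       ()
band-support zero    1       ()
band-support zero    (suc (suc (suc (suc c)))) ()
band-support (suc r) zero    ()
band-support (suc r) (suc c) h with band r c in eq
... | zero  = ⊥-elim (1+n≰n h)
... | suc _ with band-support r c (subst (1 ≤_) (sym eq) (s≤s z≤n))
...   | inj₁ refl = inj₁ refl
...   | inj₂ refl = inj₂ refl

module Staircase (k : ℕ) where

  rank : ℕ → ℕ → ℕ → ℕ
  rank 0 _ 0 = 1
  rank 0 _ 3 = 4
  rank 0 _ 4 = 5
  rank 1 _ 0 = 2
  rank 1 _ 3 = 3
  rank (suc (suc _)) 0 1 = 11 + double k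
  rank (suc (suc _)) 0 2 = 12 + double k
  rank (suc (suc _)) 1 1 = 10 + double k
  rank (suc (suc _)) 1 2 = 11 + double k
  rank (suc (suc _)) 2 2 = 9 + double k
  rank (suc (suc ρ)) (suc (suc _)) c = band (2 + ρ) c
  rank _ _ _ = 0

  open Coordinates (5 + k) rank

  -- The squares of positive rank (see ranked and rank-value); everything below is case
  -- analysis over this view.
  data Ranked : ℕ → ℕ → ℕ → Set where
    corner  : Ranked 0 (5 + k) 0
    top₃    : Ranked 0 (5 + k) 3
    top₄    : Ranked 0 (5 + k) 4
    second₀ : Ranked 1 (4 + k) 0
    second₃ : Ranked 1 (4 + k) 3
    stair₂  : ∀ {ρ ρ'} → ρ + ρ' ≡ 1 + k → Ranked (2 + ρ) (2 + ρ') (4 + ρ)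
    stair₃  : ∀ {ρ ρ'} → ρ + ρ' ≡ k → Ranked (2 + ρ) (3 + ρ') (5 + ρ)
    wrap    : Ranked (3 + k) 2 2
    penult₁ : Ranked (4 + k) 1 1
    penult₂ : Ranked (4 + k) 1 2
    last₁   : Ranked (5 + k) 0 1
    last₂   : Ranked (5 + k) 0 2

  value : ∀ {r r' c} → Ranked r r' c → ℕ
  value corner             = 1
  value top₃               = 4
  value top₄               = 5
  value second₀            = 2
  value second₃            = 3
  value (stair₂ {ρ} _)     = 6 + double ρ
  value (stair₃ {ρ} _)     = 7 + double ρ
  value wrap               = 9 + double k
  value penult₁            = 10 + double k
  value penult₂            = 11 + double k
  value last₁              = 11 + double k
  value last₂              = 12 + double k

  rank-value : ∀ {r r' c} (x : Ranked r r' c) → rank r r' c ≡ value x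
  rank-value corner                     = refl
  rank-value top₃                       = refl
  rank-value top₄                       = refl
  rank-value second₀                    = refl
  rank-value second₃                    = refl
  rank-value (stair₂ {ρ} {zero} _)      = band-at₂ (2 + ρ)
  rank-value (stair₂ {ρ} {suc _} _)     = band-at₂ (2 + ρ)
  rank-value (stair₃ {ρ} _)             = band-at₃ (2 + ρ)
  rank-value wrap                       = refl
  rank-value penult₁                    = refl
  rank-value penult₂                    = refl
  rank-value last₁                      = refl
  rank-value last₂                      = refl

  row-of-mirror : ∀ {r} j → Mirror r j → r ≡ 5 + k ∸ j
  row-of-mirror {r} j eq = trans (sym (m+n∸n≡m r j)) (cong (_∸ j) eq)

  ranked-mirror : ∀ {r r' c} → Ranked r r' c → Mirror r r'
  ranked-mirror corner       = refl
  ranked-mirror top₃         = refl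
  ranked-mirror top₄         = refl
  ranked-mirror second₀      = refl
  ranked-mirror second₃      = refl
  ranked-mirror (stair₂ eq)  = m+n≡o⇒[2+m]+[2+n]≡4+o eq
  ranked-mirror (stair₃ eq)  = m+n≡o⇒[2+m]+[2+n]≡4+o (trans (+-suc _ _) (cong suc eq))
  ranked-mirror wrap         = +-comm (3 + k) 2
  ranked-mirror penult₁      = +-comm (4 + k) 1
  ranked-mirror penult₂      = +-comm (4 + k) 1
  ranked-mirror last₁        = +-identityʳ (5 + k)
  ranked-mirror last₂        = +-identityʳ (5 + k)

  ranked-column< : ∀ {r r' c} → Ranked r r' c → c < 6 + k
  ranked-column< corner      = m≤m+n 1 (5 + k)
  ranked-column< top₃        = m≤m+n 4 (2 + k)
  ranked-column< top₄        = m≤m+n 5 (1 + k)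
  ranked-column< second₀     = m≤m+n 1 (5 + k)
  ranked-column< second₃     = m≤m+n 4 (2 + k)
  ranked-column< (stair₂ eq) = +-monoʳ-≤ 5 (m+n≡o⇒m≤o eq)
  ranked-column< (stair₃ eq) = +-monoʳ-≤ 6 (m+n≡o⇒m≤o eq)
  ranked-column< wrap        = m≤m+n 3 (3 + k)
  ranked-column< penult₁     = m≤m+n 2 (4 + k)
  ranked-column< penult₂     = m≤m+n 3 (3 + k)
  ranked-column< last₁       = m≤m+n 2 (4 + k)
  ranked-column< last₂       = m≤m+n 3 (3 + k)

  stair-row-support : ∀ ρ ρ' c → 1 ≤ rank (2 + ρ) (2 + ρ') c →
    (ρ' ≡ 0 × c ≡ 2) ⊎ c ≡ 4 + ρ ⊎ c ≡ 5 + ρ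
  stair-row-support ρ zero    2                   _ = inj₁ (refl , refl)
  stair-row-support ρ zero    0                   ()
  stair-row-support ρ zero    1                   ()
  stair-row-support ρ zero    (suc (suc (suc c))) h = inj₂ (band-support (2 + ρ) (3 + c) h)
  stair-row-support ρ (suc _) c                   h = inj₂ (band-support (2 + ρ) c h)

  ranked : ∀ {r r' c} → Mirror r r' → c < 6 + k → 1 ≤ rank r r' c → Ranked r r' c
  ranked {0} {_} {0} refl _ _ = corner
  ranked {0} {_} {3} refl _ _ = top₃
  ranked {0} {_} {4} refl _ _ = top₄
  ranked {0} {_} {1} _ _ ()
  ranked {0} {_} {2} _ _ ()
  ranked {0} {_} {suc (suc (suc (suc (suc _))))} _ _ ()
  ranked {1} {_} {0} refl _ _ = second₀
  ranked {1} {_} {3} refl _ _ = second₃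
  ranked {1} {_} {1} _ _ ()
  ranked {1} {_} {2} _ _ ()
  ranked {1} {_} {suc (suc (suc (suc _)))} _ _ ()
  ranked {r@(suc (suc _))} {0} {1} eq _ _ with row-of-mirror {r} 0 eq
  ... | refl = last₁
  ranked {r@(suc (suc _))} {0} {2} eq _ _ with row-of-mirror {r} 0 eq
  ... | refl = last₂
  ranked {suc (suc _)} {0} {0} _ _ ()
  ranked {suc (suc _)} {0} {suc (suc (suc _))} _ _ ()
  ranked {r@(suc (suc _))} {1} {1} eq _ _ with row-of-mirror {r} 1 eq
  ... | refl = penult₁
  ranked {r@(suc (suc _))} {1} {2} eq _ _ with row-of-mirror {r} 1 eq
  ... | refl = penult₂
  ranked {suc (suc _)} {1} {0} _ _ ()
  ranked {suc (suc _)} {1} {suc (suc (suc _))} _ _ ()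
  ranked {suc (suc ρ)} {suc (suc ρ')} {c} eq c<6+k h with stair-row-support ρ ρ' c h
  ... | inj₁ (refl , refl) with row-of-mirror {2 + ρ} 2 eq
  ...   | refl = wrap
  ranked {suc (suc ρ)} {suc (suc ρ')} eq c<6+k h | inj₂ (inj₁ refl) = stair₂ ([2+m]+[2+n]≡4+o⇒m+n≡o eq)
  ranked {suc (suc ρ)} {suc (suc (suc ρ'))} eq c<6+k h | inj₂ (inj₂ refl) =
    stair₃ (m+1+n≡1+o⇒m+n≡o ([2+m]+[2+n]≡4+o⇒m+n≡o eq))
  ranked {suc (suc ρ)} {2} eq c<6+k h | inj₂ (inj₂ refl) with row-of-mirror {2 + ρ} 2 eq
  ... | refl = ⊥-elim (1+n≰n c<6+k)  -- column 5 + ρ = 6 + k is off the board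

  row-partner : ∀ {r r' c} (x : Ranked r r' c) →
    Σ ℕ λ c₂ → Σ (Ranked r r' c₂) λ y → c₂ ≢ c × value x ≤ suc (value y)
  row-partner corner  = 3 , top₃ , (λ ()) , s≤s z≤n
  row-partner top₃    = 4 , top₄ , (λ ()) , m≤n+m 4 2
  row-partner top₄    = 3 , top₃ , (λ ()) , ≤-refl
  row-partner second₀ = 3 , second₃ , (λ ()) , m≤n+m 2 2
  row-partner second₃ = 0 , second₀ , (λ ()) , ≤-refl
  row-partner (stair₂ {ρ} {zero} eq) with trans (sym (+-identityʳ ρ)) eq
  ... | refl = 2 , wrap , (λ ()) , m≤n+m _ 2
  row-partner (stair₂ {ρ} {suc _} eq) = 5 + ρ , stair₃ (m+1+n≡1+o⇒m+n≡o eq) , 1+n≢n , m≤n+m _ 2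
  row-partner (stair₃ {ρ} {ρ'} eq) = 4 + ρ , stair₂ (trans (+-suc ρ ρ') (cong suc eq)) , n≢1+n , ≤-refl
  row-partner wrap    = 5 + k , stair₂ (+-identityʳ (1 + k)) , (λ ()) , ≤-refl
  row-partner penult₁ = 2 , penult₂ , (λ ()) , m≤n+m _ 2
  row-partner penult₂ = 1 , penult₁ , (λ ()) , ≤-refl
  row-partner last₁   = 2 , last₂ , (λ ()) , m≤n+m _ 2
  row-partner last₂   = 1 , last₁ , (λ ()) , ≤-refl

  column-partner : ∀ {r r' c} (x : Ranked r r' c) →
    Σ ℕ λ σ → Σ ℕ λ σ' → Σ (Ranked σ σ' c) λ y → σ ≢ r × value x ≤ suc (value y)
  column-partner corner  = 1 , 4 + k , second₀ , (λ ()) , s≤s z≤n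
  column-partner top₃    = 1 , 4 + k , second₃ , (λ ()) , ≤-refl
  column-partner top₄    = 2 , 3 + k , stair₂ refl , (λ ()) , m≤n+m _ 2
  column-partner second₀ = 0 , 5 + k , corner , (λ ()) , ≤-refl
  column-partner second₃ = 0 , 5 + k , top₃ , (λ ()) , m≤n+m _ 2
  column-partner (stair₂ {zero} _) = 0 , 5 + k , top₄ , (λ ()) , ≤-refl
  column-partner (stair₂ {suc ρ} {ρ'} eq) = 2 + ρ , 3 + ρ' , stair₃ (suc-injective eq) , n≢1+n , ≤-refl
  column-partner (stair₃ {ρ} {ρ'} eq) = 3 + ρ , 2 + ρ' , stair₂ (cong suc eq) , 1+n≢n , m≤n+m _ 2
  column-partner wrap    = 4 + k , 1 , penult₂ , 1+n≢n , m≤n+m _ 3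
  column-partner penult₁ = 5 + k , 0 , last₁ , 1+n≢n , m≤n+m _ 2
  column-partner penult₂ = 5 + k , 0 , last₂ , 1+n≢n , m≤n+m _ 2
  column-partner last₁   = 4 + k , 1 , penult₁ , n≢1+n , ≤-refl
  column-partner last₂   = 4 + k , 1 , penult₂ , n≢1+n , ≤-refl

  stair-row≢4+k : ∀ {ρ} → ρ ≤ 1 + k → 4 + k ≢ 2 + ρ
  stair-row≢4+k ρ≤1+k refl = 1+n≰n ρ≤1+k

  antidiagonal-partner : ∀ {r r'} (x : Ranked r r' r') →
    Σ ℕ λ σ → Σ ℕ λ σ' → Σ (Ranked σ σ' σ') λ y → σ ≢ r × value x ≤ suc (value y)
  antidiagonal-partner (stair₂ eq) = 4 + k , 1 , penult₁ , stair-row≢4+k (m+n≡o⇒m≤o eq) ,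
    +-monoʳ-≤ 6 (≤-trans (double-mono-≤ (m+n≡o⇒m≤o eq)) (m≤n+m _ 3))
  antidiagonal-partner (stair₃ eq) = 4 + k , 1 , penult₁ , stair-row≢4+k (m≤n⇒m≤1+n (m+n≡o⇒m≤o eq)) ,
    +-monoʳ-≤ 7 (≤-trans (double-mono-≤ (m+n≡o⇒m≤o eq)) (m≤n+m _ 4))
  antidiagonal-partner wrap    = 4 + k , 1 , penult₁ , 1+n≢n , m≤n+m _ 2
  antidiagonal-partner penult₁ = 3 + k , 2 , wrap , n≢1+n , ≤-refl

  rank-by-view : ∀ {σ σ' c} (P : ℕ → Set) → Mirror σ σ' → c < 6 + k →
    P 0 → ((y : Ranked σ σ' c) → P (value y)) → P (rank σ σ' c)
  rank-by-view {σ} {σ'} {c} P mirror c<6+k P0 P-value with 1 ≤? rank σ σ' c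
  ... | yes h = let y = ranked mirror c<6+k h in subst P (sym (rank-value y)) (P-value y)
  ... | no ¬h = subst P (sym (n<1⇒n≡0 (≰⇒> ¬h))) P0

  below-by-view : ∀ {σ σ' c v} → Mirror σ σ' → c < 6 + k →
    ((y : Ranked σ σ' c) → value y < suc v) → rank σ σ' c < suc v
  below-by-view {v = v} mirror c<6+k = rank-by-view (_< suc v) mirror c<6+k (s≤s z≤n)

  diagonal-ranked : ∀ {σ σ'} → Ranked σ σ' σ → σ ≡ 0
  diagonal-ranked corner = refl

  column₀-below : ∀ {σ σ'} → σ ≢ 1 → (y : Ranked σ σ' 0) → value y < 2
  column₀-below _   corner  = ≤-refl
  column₀-below σ≢1 second₀ = ⊥-elim (σ≢1 refl)

  column₁-below : ∀ {σ σ'} → σ ≢ 5 + k → (y : Ranked σ σ' 1) → value y < 11 + double k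
  column₁-below _     penult₁ = ≤-refl
  column₁-below σ≢5+k last₁   = ⊥-elim (σ≢5+k refl)

  column₃-below : ∀ {σ σ'} → σ ≢ 0 → (y : Ranked σ σ' 3) → value y < 4
  column₃-below σ≢0 top₃    = ⊥-elim (σ≢0 refl)
  column₃-below _   second₃ = ≤-refl

  stair-column-below : ∀ {ρ σ σ'} → σ ≢ 2 + ρ → (y : Ranked σ σ' (4 + ρ)) → value y < 6 + double ρ
  stair-column-below _   top₄       = ≤-refl
  stair-column-below σ≢  (stair₂ _) = ⊥-elim (σ≢ refl)
  stair-column-below _   (stair₃ _) = ≤-refl

  row₀-below : ∀ {r' c} → c ≢ 4 → (y : Ranked 0 r' c) → value y < 5
  row₀-below _   corner = m≤n+m 2 3
  row₀-below _   top₃   = ≤-refl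
  row₀-below c≢4 top₄   = ⊥-elim (c≢4 refl)

  row₁-below : ∀ {r' c} → c ≢ 3 → (y : Ranked 1 r' c) → value y < 3
  row₁-below _   second₀ = ≤-refl
  row₁-below c≢3 second₃ = ⊥-elim (c≢3 refl)

  stair-row-below : ∀ {ρ ρ' c} → c ≢ 5 + ρ → (y : Ranked (2 + ρ) (3 + ρ') c) → value y < 7 + double ρ
  stair-row-below _  (stair₂ _) = ≤-refl
  stair-row-below c≢ (stair₃ _) = ⊥-elim (c≢ refl)

  wrap-row-below : ∀ {c} → c ≢ 2 → (y : Ranked (3 + k) 2 c) → value y < 9 + double k
  wrap-row-below _   (stair₂ _) = ≤-refl
  wrap-row-below c≢2 wrap       = ⊥-elim (c≢2 refl)

  penult-row-below : ∀ {c} → c ≢ 2 → (y : Ranked (4 + k) 1 c) → value y < 11 + double k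
  penult-row-below _   penult₁ = ≤-refl
  penult-row-below c≢2 penult₂ = ⊥-elim (c≢2 refl)

  last-row-below : ∀ {c} → c ≢ 2 → (y : Ranked (5 + k) 0 c) → value y < 12 + double k
  last-row-below _   last₁ = ≤-refl
  last-row-below c≢2 last₂ = ⊥-elim (c≢2 refl)

  antidiagonal-below : ∀ {σ σ'} → σ ≢ 4 + k → (y : Ranked σ σ' σ') → value y < 10 + double k
  antidiagonal-below _ (stair₂ eq) =
    +-monoʳ-≤ 7 (≤-trans (double-mono-≤ (m+n≡o⇒m≤o eq)) (m≤n+m _ 1))
  antidiagonal-below _ (stair₃ eq) =
    +-monoʳ-≤ 8 (≤-trans (double-mono-≤ (m+n≡o⇒m≤o eq)) (m≤n+m _ 2))
  antidiagonal-below _     wrap    = ≤-refl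
  antidiagonal-below σ≢4+k penult₁ = ⊥-elim (σ≢4+k refl)

  mirror-row< : ∀ {σ σ'} → Mirror σ σ' → σ < 6 + k
  mirror-row< mirror = s≤s (m+n≡o⇒m≤o mirror)

  mirror-column< : ∀ {σ σ'} → Mirror σ σ' → σ' < 6 + k
  mirror-column< {σ} {σ'} mirror = s≤s (m+n≡o⇒m≤o (trans (+-comm σ' σ) mirror))

  row-trigger : ∀ {r r' c v} → Mirror r r' →
    (∀ {c₂} → c₂ ≢ c → (y : Ranked r r' c₂) → value y < suc v) → Trigger r r' c (suc v)
  row-trigger mirror below = inj₁ λ c₂<6+k c₂≢c → below-by-view mirror c₂<6+k (below c₂≢c)

  column-trigger : ∀ {r r' c v} → c < 6 + k →
    (∀ {σ σ'} → σ ≢ r → (y : Ranked σ σ' c) → value y < suc v) → Trigger r r' c (suc v)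
  column-trigger c<6+k below = inj₂ (inj₁ λ mirror σ≢r → below-by-view mirror c<6+k (below σ≢r))

  diagonal-trigger : ∀ {r r' c v} → r ≡ c →
    (∀ {σ σ'} → σ ≢ r → (y : Ranked σ σ' σ) → value y < suc v) → Trigger r r' c (suc v)
  diagonal-trigger r≡c below =
    inj₂ (inj₂ (inj₁ (r≡c , λ mirror σ≢r → below-by-view mirror (mirror-row< mirror) (below σ≢r))))

  antidiagonal-trigger : ∀ {r r' c v} → r' ≡ c →
    (∀ {σ σ'} → σ ≢ r → (y : Ranked σ σ' σ') → value y < suc v) → Trigger r r' c (suc v)
  antidiagonal-trigger r'≡c below =
    inj₂ (inj₂ (inj₂ (r'≡c , λ mirror σ≢r → below-by-view mirror (mirror-column< mirror) (below σ≢r))))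

  trigger : ∀ {r r' c} (x : Ranked r r' c) → Trigger r r' c (value x)
  trigger corner       = diagonal-trigger refl λ σ≢0 y → ⊥-elim (σ≢0 (diagonal-ranked y))
  trigger top₃         = column-trigger (ranked-column< top₃) column₃-below
  trigger top₄         = row-trigger refl row₀-below
  trigger second₀      = column-trigger (ranked-column< second₀) column₀-below
  trigger second₃      = row-trigger refl row₁-below
  trigger x@(stair₂ _) = column-trigger (ranked-column< x) stair-column-below
  trigger x@(stair₃ _) = row-trigger (ranked-mirror x) stair-row-below
  trigger wrap         = row-trigger (ranked-mirror wrap) wrap-row-below
  trigger penult₁      = antidiagonal-trigger refl antidiagonal-below
  trigger penult₂      = row-trigger (ranked-mirror penult₂) penult-row-below
  trigger last₁        = column-trigger (ranked-column< last₁) column₁-below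
  trigger last₂        = row-trigger (ranked-mirror last₂) last-row-below

  value-≤ : ∀ {r r' c} (x : Ranked r r' c) → value x ≤ 12 + double k
  value-≤ corner      = m≤m+n 1 _
  value-≤ top₃        = m≤m+n 4 _
  value-≤ top₄        = m≤m+n 5 _
  value-≤ second₀     = m≤m+n 2 _
  value-≤ second₃     = m≤m+n 3 _
  value-≤ (stair₂ eq) = +-monoʳ-≤ 6 (≤-trans (double-mono-≤ (m+n≡o⇒m≤o eq)) (m≤n+m _ 4))
  value-≤ (stair₃ eq) = +-monoʳ-≤ 7 (≤-trans (double-mono-≤ (m+n≡o⇒m≤o eq)) (m≤n+m _ 5))
  value-≤ wrap        = m≤n+m _ 3
  value-≤ penult₁     = m≤n+m _ 2
  value-≤ penult₂     = m≤n+m _ 1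
  value-≤ last₁       = m≤n+m _ 1
  value-≤ last₂       = ≤-refl

  RankedWithValue : ℕ → Set
  RankedWithValue v = Σ ℕ λ r → Σ ℕ λ r' → Σ ℕ λ c → Σ (Ranked r r' c) λ x → value x ≡ v

  ranked-with-small-value : ∀ {e} → e < 8 + double k → RankedWithValue (suc e)
  ranked-with-small-value {0} _ = _ , _ , _ , corner , refl
  ranked-with-small-value {1} _ = _ , _ , _ , second₀ , refl
  ranked-with-small-value {2} _ = _ , _ , _ , second₃ , refl
  ranked-with-small-value {3} _ = _ , _ , _ , top₃ , refl
  ranked-with-small-value {4} _ = _ , _ , _ , top₄ , refl
  ranked-with-small-value {suc (suc (suc (suc (suc j))))} (s≤s (s≤s (s≤s (s≤s (s≤s j<3+2k))))) with parity j
  ... | even q = let _ , q+ρ'≡1+k =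
                       m≤n⇒∃[o]m+o≡n (double-cancel-≤ q (1 + k) (m≤n⇒m≤1+n (≤-pred j<3+2k)))
                 in _ , _ , _ , stair₂ q+ρ'≡1+k , refl
  ... | odd q  = let _ , q+ρ'≡k = m≤n⇒∃[o]m+o≡n (double-cancel-≤ q k (≤-pred (≤-pred j<3+2k)))
                 in _ , _ , _ , stair₃ q+ρ'≡k , refl

  ranked-with-value : ∀ {e} → e < 12 + double k → RankedWithValue (suc e)
  ranked-with-value e<12+2k with m<1+n⇒m<n∨m≡n e<12+2k
  ... | inj₂ refl = _ , _ , _ , last₂ , refl
  ... | inj₁ e<11+2k with m<1+n⇒m<n∨m≡n e<11+2k
  ...   | inj₂ refl = _ , _ , _ , penult₂ , refl
  ...   | inj₁ e<10+2k with m<1+n⇒m<n∨m≡n e<10+2k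
  ...     | inj₂ refl = _ , _ , _ , penult₁ , refl
  ...     | inj₁ e<9+2k with m<1+n⇒m<n∨m≡n e<9+2k
  ...       | inj₂ refl = _ , _ , _ , wrap , refl
  ...       | inj₁ e<8+2k = ranked-with-small-value e<8+2k

  diagonal-supported : ∀ {r r'} → Ranked r r' r → OtherRowAbove (λ σ _ → σ) r (rank r r' r)
  diagonal-supported corner = 1 , 4 + k , refl , (λ ()) , ≤-refl

  supported-by-values : ∀ {r r' c σ σ' c₂} (x : Ranked r r' c) (y : Ranked σ σ' c₂) →
    value x ≤ suc (value y) → rank r r' c ≤ suc (rank σ σ' c₂)
  supported-by-values x y = subst₂ (λ a b → a ≤ suc b) (sym (rank-value x)) (sym (rank-value y))

  certificate : CoordinateCertificate (12 + double k)
  certificate = record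
    { row-supported  = λ {r} {r'} {c} mirror c<6+k h →
        let x = ranked {r} {r'} {c} mirror c<6+k h
            c₂ , y , c₂≢c , x≤1+y = row-partner x
        in c₂ , ranked-column< y , c₂≢c , supported-by-values x y x≤1+y
    ; col-supported  = λ {r} {r'} {c} mirror c<6+k h →
        let x = ranked {r} {r'} {c} mirror c<6+k h
            σ , σ' , y , σ≢r , x≤1+y = column-partner x
        in σ , σ' , ranked-mirror y , σ≢r , supported-by-values x y x≤1+y
    ; diag-supported = λ mirror h → diagonal-supported (ranked mirror (mirror-row< mirror) h)
    ; anti-supported = λ mirror h →
        let x = ranked mirror (mirror-column< mirror) h
            σ , σ' , y , σ≢r , x≤1+y = antidiagonal-partner x
        in σ , σ' , ranked-mirror y , σ≢r , supported-by-values x y x≤1+y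
    ; triggered      = λ mirror c<6+k h →
        let x = ranked mirror c<6+k h in subst (Trigger _ _ _) (sym (rank-value x)) (trigger x)
    ; bounded        = λ {r} {r'} {c} mirror c<6+k →
        rank-by-view {r} {r'} {c} (_≤ 12 + double k) mirror c<6+k z≤n value-≤
    ; attains        = λ e<12+2k →
        let r , r' , c , x , value≡ = ranked-with-value e<12+2k
        in r , r' , c , ranked-mirror x , ranked-column< x , trans (rank-value x) value≡
    }

mainTheorem3 : (n : ℕ) → 5 ≤ n →
    Σ (SqSet n) λ S → Spanning S × Σ ℕ λ d → IsDepth S d × (2 * n ≤ d)
mainTheorem3 _ (s≤s (s≤s (s≤s (s≤s (s≤s {n = zero} z≤n))))) = deep-spanning-set certificate₅ ≤-refl
mainTheorem3 _ (s≤s (s≤s (s≤s (s≤s (s≤s {n = suc k} z≤n))))) =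
  deep-spanning-set (Coordinates.toRankCertificate (5 + k) (Staircase.rank k) (Staircase.certificate k))
                    (≤-reflexive (2*-double (6 + k)))
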